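{- Let $X$ be a weighted pure $n$-dimensional simplicial complex, let $1\le k\le n-1$ and $\phi\in C^k(X,\mathbb{F}_2)$. Then $k\|d\phi\|+\|\phi\|\ge\sum_{\{v\}\in X^{(0)}}\|d_{\{v\}}\phi_{\{v\}}\|$.
   Context: $X$ is finite, $X^{(k)}$ its $k$-simplices, vertices identified with $\{v\}$. A weight is $m:\bigcup_kX^{(k)}\to(0,\infty)$ with $m(\tau)=\sum_{\sigma\in X^{(k+1)},\tau\subset\sigma}m(\sigma)$. $C^k(Y,\mathbb{F}_2)$ = functions $Y^{(k)}\to\mathbb{F}_2$, norm $\|\phi\|=\sum_{\phi(\tau)=1}m(\tau)$, differential $(d\phi)(\sigma)=\sum_{\tau\subset\sigma}\phi(\tau)$ mod 2. For $\tau\in X^{(j)}$ the link $X_\tau$ consists of simplices $\sigma$ disjoint from $\tau$ with $\sigma\cup\tau\in X$, with weight $m_\tau(\sigma)=m(\tau\cup\sigma)$ and differential $d_\tau$; norms on $X_\tau$ use $m_\tau$. The localization $\phi_\tau\in C^{k-j-1}(X_\tau,\mathbb{F}_2)$ is $\phi_\tau(\sigma)=\phi(\tau\cup\sigma)$. -}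

module Defs where

open import Level using (Level; _⊔_) renaming (suc to lsuc)
open import Data.Bool using (Bool; true; false; _∧_; not; _xor_; T; if_then_else_)
open import Data.Nat using (ℕ; zero; suc; _≡ᵇ_)
import Data.Nat as ℕ
open import Data.List using (List; []; _∷_; [_]; map; _++_; filterᵇ; foldr; allFin)
open import Data.Product using (Σ; ∃; _×_; _,_)
open import Data.Fin using (Fin)
open import Data.Fin.Subset using (Subset; inside; outside; _∪_; ⁅_⁆; ∣_∣; _⊆_; _∈_; Nonempty)
open import Data.Fin.Subset.Properties using (_⊆?_; _∈?_)
open import Relation.Nullary using (¬_; does)
open import Relation.Binary using (Rel; IsTotalOrder)
open import Relation.Binary.PropositionalEquality using (_≡_)
open import Algebra.Bundles using (CommutativeRing)

-- Ordered fields (the weights are real numbers; the standard library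
-- has no reals, so we work over an arbitrary ordered field, of which
-- ℝ is an instance).

record OrderedField (c ℓ₁ ℓ₂ : Level) : Set (lsuc (c ⊔ ℓ₁ ⊔ ℓ₂)) where
  field
    commutativeRing : CommutativeRing c ℓ₁
  open CommutativeRing commutativeRing public
  field
    _≤_          : Rel Carrier ℓ₂
    isTotalOrder : IsTotalOrder _≈_ _≤_
    +-monoʳ-≤    : ∀ z {x y} → x ≤ y → (z + x) ≤ (z + y)
    *-nonneg     : ∀ {x y} → 0# ≤ x → 0# ≤ y → 0# ≤ (x * y)
    0≉1          : ¬ (0# ≈ 1#)
    inverse      : ∀ x → ¬ (x ≈ 0#) → ∃ λ y → (x * y) ≈ 1#

  _<_ : Rel Carrier (ℓ₁ ⊔ ℓ₂)
  x < y = (x ≤ y) × ¬ (x ≈ y)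

  Σ-list : List Carrier → Carrier
  Σ-list = foldr _+_ 0#

  _·ℕ_ : ℕ → Carrier → Carrier
  zero  ·ℕ x = 0#
  suc k ·ℕ x = x + (k ·ℕ x)

allSubsets : ∀ n → List (Subset n)
allSubsets zero    = [ Data.Fin.Subset.⊥ ]
allSubsets (suc n) = map (outside ∷_) (allSubsets n) ++ map (inside ∷_) (allSubsets n)
  where open import Data.Vec using (_∷_)

_⊆ᵇ_ : ∀ {n} → Subset n → Subset n → Bool
p ⊆ᵇ q = does (p ⊆? q)

_∈ᵇ_ : ∀ {n} → Fin n → Subset n → Bool
x ∈ᵇ p = does (x ∈? p)

-- Finite simplicial complexes on the vertex set Fin N.
-- A simplex is a nonempty subset of Fin N; a j-simplex has j+1 vertices.

record Complex (N : ℕ) : Set where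
  field
    simplex  : Subset N → Bool
    nonempty : ∀ σ → T (simplex σ) → Nonempty σ
    closed   : ∀ σ τ → T (simplex σ) → τ ⊆ σ → Nonempty τ → T (simplex τ)
open Complex public

record Pure {N : ℕ} (X : Complex N) (n : ℕ) : Set where
  field
    top-exists : ∃ λ σ → T (simplex X σ) × ∣ σ ∣ ≡ suc n
    dim-bound  : ∀ σ → T (simplex X σ) → ∣ σ ∣ ℕ.≤ suc n
    in-top     : ∀ σ → T (simplex X σ) →
                 ∃ λ τ → T (simplex X τ) × ∣ τ ∣ ≡ suc n × σ ⊆ τ

faces : ∀ {N} → (Subset N → Bool) → ℕ → List (Subset N)
faces {N} S j = filterᵇ (λ σ → S σ ∧ (∣ σ ∣ ≡ᵇ suc j)) (allSubsets N)

-- F₂-cochains are represented by Bool-valued functions on subsets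
-- (only the values on j-simplices are relevant).
Cochain : ℕ → Set
Cochain N = Subset N → Bool

xor-list : List Bool → Bool
xor-list = foldr _xor_ false

d : ∀ {N} → ℕ → Cochain N → Cochain N
d {N} j φ σ = xor-list (map φ (filterᵇ (λ τ → (∣ τ ∣ ≡ᵇ suc j) ∧ (τ ⊆ᵇ σ)) (allSubsets N)))

module _ {c ℓ₁ ℓ₂} (F : OrderedField c ℓ₁ ℓ₂) where
  open OrderedField F

  norm : ∀ {N} → (Subset N → Bool) → (Subset N → Carrier) → ℕ → Cochain N → Carrier
  norm S m j φ = Σ-list (map m (filterᵇ φ (faces S j)))

  record Weight {N : ℕ} (X : Complex N) (n : ℕ) : Set (c ⊔ ℓ₁ ⊔ ℓ₂) where
    field
      m       : Subset N → Carrier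
      pos     : ∀ σ → T (simplex X σ) → 0# < m σ
      balance : ∀ j τ → j ℕ.< n → T (simplex X τ) → ∣ τ ∣ ≡ suc j →
                m τ ≈ Σ-list (map m (filterᵇ (τ ⊆ᵇ_) (faces (simplex X) (suc j))))

link : ∀ {N} → Complex N → Fin N → Subset N → Bool
link X v σ = not (v ∈ᵇ σ) ∧ simplex X (σ ∪ ⁅ v ⁆)

linkWeight : ∀ {a} {A : Set a} {N} → (Subset N → A) → Fin N → Subset N → A
linkWeight m v σ = m (σ ∪ ⁅ v ⁆)

localize : ∀ {N} → Cochain N → Fin N → Cochain N
localize φ v σ = φ (σ ∪ ⁅ v ⁆)

vertices : ∀ {N} → Complex N → List (Fin N)
vertices {N} X = filterᵇ (λ v → simplex X ⁅ v ⁆) (allFin N)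

-- Write the (k+1)-simplices of X as η = σ ∪ {v} with σ in the link of v. Since
-- (d_v φ_v)(η ∖ v) = dφ(η) + φ(η ∖ v), the left-hand side equals
-- Σ_η m(η) · #{v ∈ η : dφ(η) + φ(η ∖ v) = 1}, while the balance condition
-- m(τ) = Σ_{η ⊃ τ} m(η) turns the right-hand side into Σ_η m(η) · (k·dφ(η) + #{v ∈ η : φ(η ∖ v) = 1}).
-- So it suffices to compare the coefficients of each η. They agree when dφ(η) = 0; when dφ(η) = 1,
-- an odd, hence positive, number c of the k + 2 facets of η carry φ, and k + 2 − c ≤ k + c.

module Submission where

open import Level using (0ℓ)
open import Function using (_∘_; id; Equivalence)
open import Data.Bool using (Bool; true; false; _∧_; not; _xor_; T; if_then_else_)
open import Data.Bool.Properties
  using (T-≡; T-∧; ∧-comm; ∧-zeroʳ; ∧-identityʳ; xor-assoc; xor-same; xor-identityʳ; xor-∧-commutativeRing)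
open import Data.Nat as ℕ using (ℕ; zero; suc; _≡ᵇ_; z≤n; s≤s)
import Data.Nat.Properties as ℕ
open import Data.List using (List; []; _∷_; map; _++_; filterᵇ; foldr; allFin; tabulate)
open import Data.Vec using ([]; _∷_; here; there)
open import Data.Fin using (Fin; zero; suc)
open import Data.Fin.Properties using (_≟_)
open import Data.Product using (_,_; proj₁; proj₂)
open import Data.Fin.Subset using (Subset; inside; outside; _∪_; ⁅_⁆; ∣_∣; _⊆_; _∈_; _-_; Nonempty)
open import Data.Fin.Subset.Properties
  using (_⊆?_; x∈⁅y⁆⇒x≡y; ∪-identityʳ; p⊆q⇒∣p∣≤∣q∣; p─⊥≡p; p─x─y≡p─y─x; x∈⁅x⁆)
open import Relation.Nullary using (does; yes; no; contradiction)
open import Relation.Nullary.Decidable using (dec-false)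
open import Relation.Binary.PropositionalEquality as ≡ using (_≡_)
open import Relation.Binary using (IsTotalOrder)
open import Algebra.Bundles using (CommutativeMonoid; CommutativeRing)
open import Defs

private
  variable
    n : ℕ

≡true⇒T : ∀ {b} → b ≡ true → T b
≡true⇒T = Equivalence.from T-≡

m≤n⇒m≢ᵇ1+n : ∀ {m n} → m ℕ.≤ n → (m ≡ᵇ suc n) ≡ false
m≤n⇒m≢ᵇ1+n {zero}  z≤n       = ≡.refl
m≤n⇒m≢ᵇ1+n {suc m} (s≤s m≤n) = m≤n⇒m≢ᵇ1+n m≤n

count : ∀ {n} → (Fin n → Bool) → ℕ
count {zero}  p = 0
count {suc n} p = if p zero then suc (count (p ∘ suc)) else count (p ∘ suc)

count-∧-not+count-∧ : ∀ {n} (p b : Fin n → Bool) →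
  count (λ i → p i ∧ not (b i)) ℕ.+ count (λ i → p i ∧ b i) ≡ count p
count-∧-not+count-∧ {zero}  p b = ≡.refl
count-∧-not+count-∧ {suc n} p b with p zero | b zero
... | true  | true  = ≡.trans (ℕ.+-suc _ _) (≡.cong suc (count-∧-not+count-∧ (p ∘ suc) (b ∘ suc)))
... | true  | false = ≡.cong suc (count-∧-not+count-∧ (p ∘ suc) (b ∘ suc))
... | false | _     = count-∧-not+count-∧ (p ∘ suc) (b ∘ suc)

∣p∣≡0⇒x∉ᵇp : ∀ {p : Subset n} → ∣ p ∣ ≡ 0 → ∀ x → (x ∈ᵇ p) ≡ false
∣p∣≡0⇒x∉ᵇp {p = outside ∷ p} ∣p∣≡0 zero    = ≡.refl
∣p∣≡0⇒x∉ᵇp {p = outside ∷ p} ∣p∣≡0 (suc x) = ∣p∣≡0⇒x∉ᵇp ∣p∣≡0 x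

x∉ᵇp⇒∣p∪⁅x⁆∣≡1+∣p∣ : ∀ (p : Subset n) x → (x ∈ᵇ p) ≡ false → ∣ p ∪ ⁅ x ⁆ ∣ ≡ suc ∣ p ∣
x∉ᵇp⇒∣p∪⁅x⁆∣≡1+∣p∣ (outside ∷ p) zero    x∉p = ≡.cong suc (≡.cong ∣_∣ (∪-identityʳ p))
x∉ᵇp⇒∣p∪⁅x⁆∣≡1+∣p∣ (outside ∷ p) (suc x) x∉p = x∉ᵇp⇒∣p∪⁅x⁆∣≡1+∣p∣ p x x∉p
x∉ᵇp⇒∣p∪⁅x⁆∣≡1+∣p∣ (inside  ∷ p) (suc x) x∉p = ≡.cong suc (x∉ᵇp⇒∣p∪⁅x⁆∣≡1+∣p∣ p x x∉p)

x∈ᵇp⇒x∈p : ∀ (p : Subset n) x → (x ∈ᵇ p) ≡ true → x ∈ p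
x∈ᵇp⇒x∈p (inside ∷ p) zero    _   = here
x∈ᵇp⇒x∈p (b      ∷ p) (suc x) x∈p = there (x∈ᵇp⇒x∈p p x x∈p)

∣p∣≡1+m⇒Nonempty : ∀ {m} (p : Subset n) → ∣ p ∣ ≡ suc m → Nonempty p
∣p∣≡1+m⇒Nonempty (inside  ∷ p) _       = zero , here
∣p∣≡1+m⇒Nonempty (outside ∷ p) ∣p∣≡1+m with ∣p∣≡1+m⇒Nonempty p ∣p∣≡1+m
... | x , x∈p = suc x , there x∈p

x∈ᵇp⇒1+∣p-x∣≡∣p∣ : ∀ (p : Subset n) x → (x ∈ᵇ p) ≡ true → suc ∣ p - x ∣ ≡ ∣ p ∣
x∈ᵇp⇒1+∣p-x∣≡∣p∣ (inside  ∷ p) zero    x∈p = ≡.cong suc (≡.cong ∣_∣ (p─⊥≡p p))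
x∈ᵇp⇒1+∣p-x∣≡∣p∣ (outside ∷ p) (suc x) x∈p = x∈ᵇp⇒1+∣p-x∣≡∣p∣ p x x∈p
x∈ᵇp⇒1+∣p-x∣≡∣p∣ (inside  ∷ p) (suc x) x∈p = ≡.cong suc (x∈ᵇp⇒1+∣p-x∣≡∣p∣ p x x∈p)

x∈ᵇp⇒p-x∪⁅x⁆≡p : ∀ (p : Subset n) x → (x ∈ᵇ p) ≡ true → (p - x) ∪ ⁅ x ⁆ ≡ p
x∈ᵇp⇒p-x∪⁅x⁆≡p (inside ∷ p) zero    x∈p = ≡.cong (inside ∷_) (≡.trans (∪-identityʳ (p ─ ⊥)) (p─⊥≡p p))
  where open Data.Fin.Subset using (_─_; ⊥)
x∈ᵇp⇒p-x∪⁅x⁆≡p (outside ∷ p) (suc x) x∈p = ≡.cong (outside ∷_) (x∈ᵇp⇒p-x∪⁅x⁆≡p p x x∈p)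
x∈ᵇp⇒p-x∪⁅x⁆≡p (inside  ∷ p) (suc x) x∈p = ≡.cong (inside ∷_) (x∈ᵇp⇒p-x∪⁅x⁆≡p p x x∈p)

x∈ᵇp-y : ∀ (p : Subset n) x y → (x ∈ᵇ (p - y)) ≡ (x ∈ᵇ p ∧ not (does (x ≟ y)))
x∈ᵇp-y (b       ∷ p) zero    zero    = ≡.sym (∧-zeroʳ (zero ∈ᵇ (b ∷ p)))
x∈ᵇp-y (inside  ∷ p) zero    (suc y) = ≡.refl
x∈ᵇp-y (outside ∷ p) zero    (suc y) = ≡.refl
x∈ᵇp-y (b       ∷ p) (suc x) zero    =
  ≡.trans (≡.cong (x ∈ᵇ_) (p─⊥≡p p)) (≡.sym (∧-identityʳ (x ∈ᵇ p)))
x∈ᵇp-y (b ∷ p) (suc x) (suc y) = x∈ᵇp-y p x y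

count-∈ᵇ : ∀ (p : Subset n) → count (_∈ᵇ p) ≡ ∣ p ∣
count-∈ᵇ []            = ≡.refl
count-∈ᵇ (inside  ∷ p) = ≡.cong suc (count-∈ᵇ p)
count-∈ᵇ (outside ∷ p) = count-∈ᵇ p

module Sums {c ℓ} (M : CommutativeMonoid c ℓ) where
  open CommutativeMonoid M
  open import Algebra.Properties.CommutativeMonoid.Sum M public
    using (sum; sum-syntax; ∑-distrib-+; sum-cong-≋; sum-replicate-zero)
  open import Algebra.Properties.CommutativeSemigroup commutativeSemigroup using (interchange)

  infixr 10 ⟦_⟧·_

  ⟦_⟧·_ : Bool → Carrier → Carrier
  ⟦ true  ⟧· x = x
  ⟦ false ⟧· x = ε

  -- Written as foldr over map so that Σ-list (map f xs), norm and the coboundary d unfold to it.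
  ∑ₗ : ∀ {a} {A : Set a} → List A → (A → Carrier) → Carrier
  ∑ₗ xs f = foldr _∙_ ε (map f xs)

  ⟦⟧-∧ : ∀ a b x → ⟦ a ∧ b ⟧· x ≡ ⟦ a ⟧· ⟦ b ⟧· x
  ⟦⟧-∧ true  b x = ≡.refl
  ⟦⟧-∧ false b x = ≡.refl

  ⟦⟧-congʳ : ∀ b {x y} → x ≈ y → ⟦ b ⟧· x ≈ ⟦ b ⟧· y
  ⟦⟧-congʳ true  x≈y = x≈y
  ⟦⟧-congʳ false x≈y = refl

  ⟦⟧-comm : ∀ a b x → ⟦ a ⟧· ⟦ b ⟧· x ≡ ⟦ b ⟧· ⟦ a ⟧· x
  ⟦⟧-comm true  true  x = ≡.refl
  ⟦⟧-comm true  false x = ≡.refl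
  ⟦⟧-comm false true  x = ≡.refl
  ⟦⟧-comm false false x = ≡.refl

  ⟦⟧-ε : ∀ b → ⟦ b ⟧· ε ≡ ε
  ⟦⟧-ε true  = ≡.refl
  ⟦⟧-ε false = ≡.refl

  ∑-zero : ∀ {n} {f : Fin n → Carrier} → (∀ i → f i ≈ ε) → ∑[ i < n ] f i ≈ ε
  ∑-zero {n} f≈ε = trans (sum-cong-≋ f≈ε) (sum-replicate-zero n)

  open import Algebra.Properties.Monoid.Mult monoid public using (_×_)

  ∑-⟦⟧-const : ∀ {n} (p : Fin n → Bool) x → ∑[ i < n ] ⟦ p i ⟧· x ≈ count p × x
  ∑-⟦⟧-const {zero}  p x = refl
  ∑-⟦⟧-const {suc n} p x with p zero
  ... | true  = ∙-congˡ (∑-⟦⟧-const (p ∘ suc) x)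
  ... | false = trans (identityˡ _) (∑-⟦⟧-const (p ∘ suc) x)

  ∑-⟦≟⟧ : ∀ {n} (j : Fin n) (f : Fin n → Carrier) → ∑[ i < n ] ⟦ does (i ≟ j) ⟧· f i ≈ f j
  ∑-⟦≟⟧ {suc n} zero    f = trans (∙-congˡ (∑-zero {n} (λ _ → refl))) (identityʳ (f zero))
  ∑-⟦≟⟧ {suc n} (suc j) f = trans (identityˡ _) (∑-⟦≟⟧ j (f ∘ suc))

  module _ {a} {A : Set a} where

    ∑ₗ-cong : ∀ xs {f g : A → Carrier} → (∀ x → f x ≈ g x) → ∑ₗ xs f ≈ ∑ₗ xs g
    ∑ₗ-cong []       f≈g = refl
    ∑ₗ-cong (x ∷ xs) f≈g = ∙-cong (f≈g x) (∑ₗ-cong xs f≈g)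

    ∑ₗ-zero : ∀ xs {f : A → Carrier} → (∀ x → f x ≈ ε) → ∑ₗ xs f ≈ ε
    ∑ₗ-zero []       f≈ε = refl
    ∑ₗ-zero (x ∷ xs) f≈ε = trans (∙-cong (f≈ε x) (∑ₗ-zero xs f≈ε)) (identityˡ ε)

    ∑ₗ-++ : ∀ xs ys (f : A → Carrier) → ∑ₗ (xs ++ ys) f ≈ ∑ₗ xs f ∙ ∑ₗ ys f
    ∑ₗ-++ []       ys f = sym (identityˡ _)
    ∑ₗ-++ (x ∷ xs) ys f = trans (∙-congˡ (∑ₗ-++ xs ys f)) (sym (assoc _ _ _))

    ∑ₗ-map : ∀ {b} {B : Set b} (g : B → A) xs (f : A → Carrier) → ∑ₗ (map g xs) f ≡ ∑ₗ xs (f ∘ g)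
    ∑ₗ-map g []       f = ≡.refl
    ∑ₗ-map g (x ∷ xs) f = ≡.cong (f (g x) ∙_) (∑ₗ-map g xs f)

    ∑ₗ-filterᵇ : ∀ (p : A → Bool) xs f → ∑ₗ (filterᵇ p xs) f ≈ ∑ₗ xs (λ x → ⟦ p x ⟧· f x)
    ∑ₗ-filterᵇ p []       f = refl
    ∑ₗ-filterᵇ p (x ∷ xs) f with p x
    ... | true  = ∙-congˡ (∑ₗ-filterᵇ p xs f)
    ... | false = trans (∑ₗ-filterᵇ p xs f) (sym (identityˡ _))

    ∑ₗ-distrib : ∀ xs (f g : A → Carrier) → ∑ₗ xs (λ x → f x ∙ g x) ≈ ∑ₗ xs f ∙ ∑ₗ xs g
    ∑ₗ-distrib []       f g = sym (identityˡ ε)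
    ∑ₗ-distrib (x ∷ xs) f g = trans (∙-congˡ (∑ₗ-distrib xs f g)) (interchange _ _ _ _)

    ∑ₗ-⟦⟧ : ∀ xs b (f : A → Carrier) → ∑ₗ xs (λ x → ⟦ b ⟧· f x) ≈ ⟦ b ⟧· ∑ₗ xs f
    ∑ₗ-⟦⟧ xs true  f = refl
    ∑ₗ-⟦⟧ xs false f = ∑ₗ-zero xs (λ _ → refl)

    ∑-∑ₗ-comm : ∀ {n} xs (f : Fin n → A → Carrier) → ∑[ i < n ] ∑ₗ xs (f i) ≈ ∑ₗ xs (λ x → ∑[ i < n ] f i x)
    ∑-∑ₗ-comm {zero}  xs f = sym (∑ₗ-zero xs (λ _ → refl))
    ∑-∑ₗ-comm {suc n} xs f =
      trans (∙-congˡ (∑-∑ₗ-comm xs (f ∘ suc))) (sym (∑ₗ-distrib xs (f zero) _))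

  ∑ₗ-comm : ∀ {a b} {A : Set a} {B : Set b} xs ys (f : A → B → Carrier) →
    ∑ₗ xs (λ x → ∑ₗ ys (f x)) ≈ ∑ₗ ys (λ y → ∑ₗ xs (λ x → f x y))
  ∑ₗ-comm []       ys f = sym (∑ₗ-zero ys (λ _ → refl))
  ∑ₗ-comm (x ∷ xs) ys f = trans (∙-congˡ (∑ₗ-comm xs ys f)) (sym (∑ₗ-distrib ys (f x) _))

  ∑ₗ-tabulate : ∀ {a} {A : Set a} {n} (g : Fin n → A) (f : A → Carrier) → ∑ₗ (tabulate g) f ≡ ∑[ i < n ] f (g i)
  ∑ₗ-tabulate {n = zero}  g f = ≡.refl
  ∑ₗ-tabulate {n = suc n} g f = ≡.cong (f (g zero) ∙_) (∑ₗ-tabulate (g ∘ suc) f)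

module SubsetSums {c ℓ} (M : CommutativeMonoid c ℓ) where
  open CommutativeMonoid M
  open Sums M
  open import Relation.Binary.Reasoning.Setoid setoid

  ∑ₗ-allSubsets-suc : ∀ n (f : Subset (suc n) → Carrier) →
    ∑ₗ (allSubsets (suc n)) f ≈ ∑ₗ (allSubsets n) (f ∘ (outside ∷_)) ∙ ∑ₗ (allSubsets n) (f ∘ (inside ∷_))
  ∑ₗ-allSubsets-suc n f = begin
    ∑ₗ (map (outside ∷_) (allSubsets n) ++ map (inside ∷_) (allSubsets n)) f
      ≈⟨ ∑ₗ-++ (map (outside ∷_) (allSubsets n)) _ f ⟩
    ∑ₗ (map (outside ∷_) (allSubsets n)) f ∙ ∑ₗ (map (inside ∷_) (allSubsets n)) f
      ≡⟨ ≡.cong₂ _∙_ (∑ₗ-map (outside ∷_) (allSubsets n) f) (∑ₗ-map (inside ∷_) (allSubsets n) f) ⟩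
    ∑ₗ (allSubsets n) (f ∘ (outside ∷_)) ∙ ∑ₗ (allSubsets n) (f ∘ (inside ∷_)) ∎

  ∑ₗ-∪⁅⁆ : ∀ n (x : Fin n) (f : Subset n → Subset n → Carrier) →
    ∑ₗ (allSubsets n) (λ σ → ⟦ not (x ∈ᵇ σ) ⟧· f (σ ∪ ⁅ x ⁆) σ) ≈
    ∑ₗ (allSubsets n) (λ η → ⟦ x ∈ᵇ η ⟧· f η (η - x))
  ∑ₗ-∪⁅⁆ (suc n) zero f = begin
    ∑ₗ (allSubsets (suc n)) (λ σ → ⟦ not (zero ∈ᵇ σ) ⟧· f (σ ∪ ⁅ zero ⁆) σ)
      ≈⟨ ∑ₗ-allSubsets-suc n _ ⟩
    ∑ₗ (allSubsets n) (λ σ → f (inside ∷ σ ∪ ⊥) (outside ∷ σ)) ∙ ∑ₗ (allSubsets n) (λ _ → ε)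
      ≈⟨ ∙-congʳ (∑ₗ-cong (allSubsets n) (λ σ → reflexive
           (≡.cong₂ (λ η σ′ → f (inside ∷ η) (outside ∷ σ′)) (∪-identityʳ σ) (≡.sym (p─⊥≡p σ))))) ⟩
    ∑ₗ (allSubsets n) (λ σ → f (inside ∷ σ) (outside ∷ (σ ─ ⊥))) ∙ ∑ₗ (allSubsets n) (λ _ → ε)
      ≈⟨ comm _ _ ⟩
    ∑ₗ (allSubsets n) (λ _ → ε) ∙ ∑ₗ (allSubsets n) (λ η → f (inside ∷ η) (outside ∷ (η ─ ⊥)))
      ≈⟨ ∑ₗ-allSubsets-suc n _ ⟨
    ∑ₗ (allSubsets (suc n)) (λ η → ⟦ zero ∈ᵇ η ⟧· f η (η - zero)) ∎
    where
    open Data.Fin.Subset using (_─_; ⊥)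
  ∑ₗ-∪⁅⁆ (suc n) (suc x) f = begin
    ∑ₗ (allSubsets (suc n)) (λ σ → ⟦ not (suc x ∈ᵇ σ) ⟧· f (σ ∪ ⁅ suc x ⁆) σ)
      ≈⟨ ∑ₗ-allSubsets-suc n _ ⟩
    ∑ₗ (allSubsets n) (λ σ → ⟦ not (x ∈ᵇ σ) ⟧· f (outside ∷ σ ∪ ⁅ x ⁆) (outside ∷ σ)) ∙
    ∑ₗ (allSubsets n) (λ σ → ⟦ not (x ∈ᵇ σ) ⟧· f (inside ∷ σ ∪ ⁅ x ⁆) (inside ∷ σ))
      ≈⟨ ∙-cong (∑ₗ-∪⁅⁆ n x (λ η σ → f (outside ∷ η) (outside ∷ σ)))
                (∑ₗ-∪⁅⁆ n x (λ η σ → f (inside ∷ η) (inside ∷ σ))) ⟩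
    ∑ₗ (allSubsets n) (λ η → ⟦ x ∈ᵇ η ⟧· f (outside ∷ η) (outside ∷ (η - x))) ∙
    ∑ₗ (allSubsets n) (λ η → ⟦ x ∈ᵇ η ⟧· f (inside ∷ η) (inside ∷ (η - x)))
      ≈⟨ ∑ₗ-allSubsets-suc n _ ⟨
    ∑ₗ (allSubsets (suc n)) (λ η → ⟦ suc x ∈ᵇ η ⟧· f η (η - suc x)) ∎

  ∑ₗ-⊆-sameSize : ∀ n (η : Subset n) (f : Subset n → Carrier) →
    ∑ₗ (allSubsets n) (λ τ → ⟦ τ ⊆ᵇ η ∧ (∣ τ ∣ ≡ᵇ ∣ η ∣) ⟧· f τ) ≈ f η
  ∑ₗ-⊆-sameSize zero [] f = identityʳ (f [])
  ∑ₗ-⊆-sameSize (suc n) (outside ∷ η) f = begin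
    ∑ₗ (allSubsets (suc n)) (λ τ → ⟦ τ ⊆ᵇ (outside ∷ η) ∧ (∣ τ ∣ ≡ᵇ ∣ η ∣) ⟧· f τ)
      ≈⟨ ∑ₗ-allSubsets-suc n _ ⟩
    ∑ₗ (allSubsets n) (λ σ → ⟦ σ ⊆ᵇ η ∧ (∣ σ ∣ ≡ᵇ ∣ η ∣) ⟧· f (outside ∷ σ)) ∙
    ∑ₗ (allSubsets n) (λ σ → ε)
      ≈⟨ ∙-cong (∑ₗ-⊆-sameSize n η _) (∑ₗ-zero (allSubsets n) λ _ → refl) ⟩
    f (outside ∷ η) ∙ ε
      ≈⟨ identityʳ _ ⟩
    f (outside ∷ η) ∎
  ∑ₗ-⊆-sameSize (suc n) (inside ∷ η) f = begin
    ∑ₗ (allSubsets (suc n)) (λ τ → ⟦ τ ⊆ᵇ (inside ∷ η) ∧ (∣ τ ∣ ≡ᵇ suc ∣ η ∣) ⟧· f τ)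
      ≈⟨ ∑ₗ-allSubsets-suc n _ ⟩
    ∑ₗ (allSubsets n) (λ σ → ⟦ σ ⊆ᵇ η ∧ (∣ σ ∣ ≡ᵇ suc ∣ η ∣) ⟧· f (outside ∷ σ)) ∙
    ∑ₗ (allSubsets n) (λ σ → ⟦ σ ⊆ᵇ η ∧ (∣ σ ∣ ≡ᵇ ∣ η ∣) ⟧· f (inside ∷ σ))
      ≈⟨ ∙-cong (∑ₗ-zero (allSubsets n) too-small) (∑ₗ-⊆-sameSize n η _) ⟩
    ε ∙ f (inside ∷ η)
      ≈⟨ identityˡ _ ⟩
    f (inside ∷ η) ∎
    where
    too-small : ∀ σ → ⟦ σ ⊆ᵇ η ∧ (∣ σ ∣ ≡ᵇ suc ∣ η ∣) ⟧· f (outside ∷ σ) ≈ ε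
    too-small σ with σ ⊆? η
    ... | no _     = refl
    ... | yes σ⊆η rewrite m≤n⇒m≢ᵇ1+n (p⊆q⇒∣p∣≤∣q∣ σ⊆η) = refl

  ∑ₗ-⊆-facets : ∀ n (η : Subset n) j → ∣ η ∣ ≡ suc j → (f : Subset n → Carrier) →
    ∑ₗ (allSubsets n) (λ τ → ⟦ τ ⊆ᵇ η ∧ (∣ τ ∣ ≡ᵇ j) ⟧· f τ) ≈ ∑[ x < n ] ⟦ x ∈ᵇ η ⟧· f (η - x)
  ∑ₗ-⊆-facets (suc n) (outside ∷ η) j ∣η∣≡1+j f = begin
    ∑ₗ (allSubsets (suc n)) (λ τ → ⟦ τ ⊆ᵇ (outside ∷ η) ∧ (∣ τ ∣ ≡ᵇ j) ⟧· f τ)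
      ≈⟨ ∑ₗ-allSubsets-suc n _ ⟩
    ∑ₗ (allSubsets n) (λ σ → ⟦ σ ⊆ᵇ η ∧ (∣ σ ∣ ≡ᵇ j) ⟧· f (outside ∷ σ)) ∙
    ∑ₗ (allSubsets n) (λ σ → ε)
      ≈⟨ ∙-cong (∑ₗ-⊆-facets n η j ∣η∣≡1+j _) (∑ₗ-zero (allSubsets n) λ _ → refl) ⟩
    (∑[ x < n ] ⟦ x ∈ᵇ η ⟧· f (outside ∷ (η - x))) ∙ ε
      ≈⟨ comm _ _ ⟩
    ∑[ x < suc n ] ⟦ x ∈ᵇ (outside ∷ η) ⟧· f ((outside ∷ η) - x) ∎
  ∑ₗ-⊆-facets (suc n) (inside ∷ η) j ∣η∣≡1+j f = begin
    ∑ₗ (allSubsets (suc n)) (λ τ → ⟦ τ ⊆ᵇ (inside ∷ η) ∧ (∣ τ ∣ ≡ᵇ j) ⟧· f τ)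
      ≈⟨ ∑ₗ-allSubsets-suc n _ ⟩
    ∑ₗ (allSubsets n) (λ σ → ⟦ σ ⊆ᵇ η ∧ (∣ σ ∣ ≡ᵇ j) ⟧· f (outside ∷ σ)) ∙
    ∑ₗ (allSubsets n) (λ σ → ⟦ σ ⊆ᵇ η ∧ (suc ∣ σ ∣ ≡ᵇ j) ⟧· f (inside ∷ σ))
      ≈⟨ ∙-cong (without-first (ℕ.suc-injective ∣η∣≡1+j)) (with-first j (ℕ.suc-injective ∣η∣≡1+j)) ⟩
    ∑[ x < suc n ] ⟦ x ∈ᵇ (inside ∷ η) ⟧· f ((inside ∷ η) - x) ∎
    where
    open Data.Fin.Subset using (_─_; ⊥)
    without-first : ∣ η ∣ ≡ j →
      ∑ₗ (allSubsets n) (λ σ → ⟦ σ ⊆ᵇ η ∧ (∣ σ ∣ ≡ᵇ j) ⟧· f (outside ∷ σ)) ≈ f (outside ∷ (η ─ ⊥))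
    without-first ≡.refl rewrite p─⊥≡p η = ∑ₗ-⊆-sameSize n η _
    with-first : ∀ j → ∣ η ∣ ≡ j →
      ∑ₗ (allSubsets n) (λ σ → ⟦ σ ⊆ᵇ η ∧ (suc ∣ σ ∣ ≡ᵇ j) ⟧· f (inside ∷ σ)) ≈
      ∑[ x < n ] ⟦ x ∈ᵇ η ⟧· f (inside ∷ (η - x))
    with-first zero    ∣η∣≡0 =
      trans (∑ₗ-zero (allSubsets n) λ σ → reflexive (≡.cong (⟦_⟧· f (inside ∷ σ)) (∧-zeroʳ (σ ⊆ᵇ η))))
      (sym (∑-zero λ x → reflexive (≡.cong (⟦_⟧· f (inside ∷ (η - x))) (∣p∣≡0⇒x∉ᵇp ∣η∣≡0 x))))
    with-first (suc j) ∣η∣≡1+j = ∑ₗ-⊆-facets n η j ∣η∣≡1+j _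

⊕-commutativeMonoid : CommutativeMonoid 0ℓ 0ℓ
⊕-commutativeMonoid = CommutativeRing.+-commutativeMonoid xor-∧-commutativeRing

module ParitySums where
  open Sums ⊕-commutativeMonoid

  ∑-remove : ∀ {n} (p b : Fin n → Bool) j → p j ≡ true →
    ∑[ i < n ] ⟦ p i ∧ not (does (i ≟ j)) ⟧· b i ≡ (∑[ i < n ] ⟦ p i ⟧· b i) xor b j
  ∑-remove {n} p b j pj = begin
    rest                          ≡⟨ xor-identityʳ rest ⟨
    rest xor false                ≡⟨ ≡.cong (rest xor_) (xor-same (b j)) ⟨
    rest xor (b j xor b j)        ≡⟨ xor-assoc rest (b j) (b j) ⟨
    (rest xor b j) xor b j        ≡⟨ ≡.cong (_xor b j) split ⟨
    (∑[ i < n ] ⟦ p i ⟧· b i) xor b j ∎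
    where
    open ≡.≡-Reasoning
    rest : Bool
    rest = ∑[ i < n ] ⟦ p i ∧ not (does (i ≟ j)) ⟧· b i
    term : ∀ i → ⟦ p i ⟧· b i ≡ ⟦ p i ∧ not (does (i ≟ j)) ⟧· b i xor ⟦ does (i ≟ j) ⟧· ⟦ p i ⟧· b i
    term i with does (i ≟ j) | p i
    ... | true  | pi    = ≡.sym (≡.cong (λ q → ⟦ q ⟧· b i xor ⟦ pi ⟧· b i) (∧-zeroʳ pi))
    ... | false | true  = ≡.sym (xor-identityʳ (b i))
    ... | false | false = ≡.refl
    split : ∑[ i < n ] ⟦ p i ⟧· b i ≡ rest xor b j
    split = begin
      ∑[ i < n ] ⟦ p i ⟧· b i
        ≡⟨ sum-cong-≋ term ⟩
      ∑[ i < n ] (⟦ p i ∧ not (does (i ≟ j)) ⟧· b i xor ⟦ does (i ≟ j) ⟧· ⟦ p i ⟧· b i)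
        ≡⟨ ∑-distrib-+ (λ i → ⟦ p i ∧ not (does (i ≟ j)) ⟧· b i) (λ i → ⟦ does (i ≟ j) ⟧· ⟦ p i ⟧· b i) ⟩
      rest xor ∑[ i < n ] ⟦ does (i ≟ j) ⟧· ⟦ p i ⟧· b i
        ≡⟨ ≡.cong (rest xor_) (∑-⟦≟⟧ j (λ i → ⟦ p i ⟧· b i)) ⟩
      rest xor ⟦ p j ⟧· b j
        ≡⟨ ≡.cong (λ pj → rest xor ⟦ pj ⟧· b j) pj ⟩
      rest xor b j ∎

  count-∧≡0⇒∑≡false : ∀ {n} (p b : Fin n → Bool) → count (λ i → p i ∧ b i) ≡ 0 → ∑[ i < n ] ⟦ p i ⟧· b i ≡ false
  count-∧≡0⇒∑≡false {zero}  p b _ = ≡.refl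
  count-∧≡0⇒∑≡false {suc n} p b count≡0 with p zero | b zero
  ... | true  | false = count-∧≡0⇒∑≡false (p ∘ suc) (b ∘ suc) count≡0
  ... | false | _     = count-∧≡0⇒∑≡false (p ∘ suc) (b ∘ suc) count≡0

  ∑≡true⇒count-∧-not≤ : ∀ {n} k (p b : Fin n → Bool) → count p ℕ.≤ 2 ℕ.+ k → ∑[ i < n ] ⟦ p i ⟧· b i ≡ true →
    count (λ i → p i ∧ not (b i)) ℕ.≤ k ℕ.+ count (λ i → p i ∧ b i)
  ∑≡true⇒count-∧-not≤ k p b count≤2+k odd with count (λ i → p i ∧ b i) in count-∧≡
  ... | zero  = contradiction (≡.trans (≡.sym (count-∧≡0⇒∑≡false p b count-∧≡)) odd) λ ()
  ... | suc c = begin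
    unmarked  ≤⟨ ℕ.m+n≤o⇒m≤o unmarked (ℕ.s≤s⁻¹ total≤) ⟩
    suc k     ≡⟨ ℕ.+-comm 1 k ⟩
    k ℕ.+ 1   ≤⟨ ℕ.+-monoʳ-≤ k (s≤s z≤n) ⟩
    k ℕ.+ suc c ∎
    where
    open ℕ.≤-Reasoning
    unmarked : ℕ
    unmarked = count (λ i → p i ∧ not (b i))
    total≤ : suc (unmarked ℕ.+ c) ℕ.≤ 2 ℕ.+ k
    total≤ = begin
      suc (unmarked ℕ.+ c)                       ≡⟨ ℕ.+-suc unmarked c ⟨
      unmarked ℕ.+ suc c                         ≡⟨ ≡.cong (unmarked ℕ.+_) count-∧≡ ⟨
      unmarked ℕ.+ count (λ i → p i ∧ b i)       ≡⟨ count-∧-not+count-∧ p b ⟩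
      count p                                    ≤⟨ count≤2+k ⟩
      2 ℕ.+ k                                    ∎


module Coboundary {N : ℕ} where
  open Sums ⊕-commutativeMonoid
  open SubsetSums ⊕-commutativeMonoid
  open ParitySums using (∑-remove)

  d-facets : ∀ j (ψ : Cochain N) η → ∣ η ∣ ≡ suc (suc j) → d j ψ η ≡ ∑[ x < N ] ⟦ x ∈ᵇ η ⟧· ψ (η - x)
  d-facets j ψ η ∣η∣≡2+j = begin
    d j ψ η
      ≡⟨ ∑ₗ-filterᵇ (λ τ → (∣ τ ∣ ≡ᵇ suc j) ∧ τ ⊆ᵇ η) (allSubsets N) ψ ⟩
    ∑ₗ (allSubsets N) (λ τ → ⟦ (∣ τ ∣ ≡ᵇ suc j) ∧ τ ⊆ᵇ η ⟧· ψ τ)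
      ≡⟨ ∑ₗ-cong (allSubsets N) (λ τ → ≡.cong (⟦_⟧· ψ τ) (∧-comm (∣ τ ∣ ≡ᵇ suc j) (τ ⊆ᵇ η))) ⟩
    ∑ₗ (allSubsets N) (λ τ → ⟦ τ ⊆ᵇ η ∧ (∣ τ ∣ ≡ᵇ suc j) ⟧· ψ τ)
      ≡⟨ ∑ₗ-⊆-facets N η (suc j) ∣η∣≡2+j ψ ⟩
    ∑[ x < N ] ⟦ x ∈ᵇ η ⟧· ψ (η - x) ∎
    where open ≡.≡-Reasoning

  d-localize : ∀ j (φ : Cochain N) η x → (x ∈ᵇ η) ≡ true → ∣ η ∣ ≡ 3 ℕ.+ j →
    d j (localize φ x) (η - x) ≡ d (suc j) φ η xor φ (η - x)
  d-localize j φ η x x∈η ∣η∣≡3+j = begin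
    d j (localize φ x) (η - x)
      ≡⟨ d-facets j (localize φ x) (η - x) (ℕ.suc-injective (≡.trans (x∈ᵇp⇒1+∣p-x∣≡∣p∣ η x x∈η) ∣η∣≡3+j)) ⟩
    ∑[ y < N ] ⟦ y ∈ᵇ (η - x) ⟧· φ ((η - x - y) ∪ ⁅ x ⁆)
      ≡⟨ sum-cong-≋ term ⟩
    ∑[ y < N ] ⟦ y ∈ᵇ η ∧ not (does (y ≟ x)) ⟧· φ (η - y)
      ≡⟨ ∑-remove (_∈ᵇ η) (λ y → φ (η - y)) x x∈η ⟩
    (∑[ y < N ] ⟦ y ∈ᵇ η ⟧· φ (η - y)) xor φ (η - x)
      ≡⟨ ≡.cong (_xor φ (η - x)) (d-facets (suc j) φ η ∣η∣≡3+j) ⟨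
    d (suc j) φ η xor φ (η - x) ∎
    where
    open ≡.≡-Reasoning
    term : ∀ y → ⟦ y ∈ᵇ (η - x) ⟧· φ ((η - x - y) ∪ ⁅ x ⁆) ≡ ⟦ y ∈ᵇ η ∧ not (does (y ≟ x)) ⟧· φ (η - y)
    term y rewrite x∈ᵇp-y η y x with y ≟ x
    ... | yes _ rewrite ∧-zeroʳ (y ∈ᵇ η) = ≡.refl
    ... | no y≢x rewrite ∧-identityʳ (y ∈ᵇ η) with y ∈ᵇ η
    ...   | false = ≡.refl
    ...   | true  = ≡.cong φ (≡.trans (≡.cong (_∪ ⁅ x ⁆) (p─x─y≡p─y─x η x y))
                                     (x∈ᵇp⇒p-x∪⁅x⁆≡p (η - y) x x∈η-y))
      where
      x∈η-y : (x ∈ᵇ (η - y)) ≡ true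
      x∈η-y = ≡.trans (x∈ᵇp-y η x y) (≡.cong₂ (λ a b → a ∧ not b) x∈η (dec-false (x ≟ y) (y≢x ∘ ≡.sym)))

module OrderedFieldSums {c ℓ₁ ℓ₂} (F : OrderedField c ℓ₁ ℓ₂) where
  open OrderedField F hiding (zero)
  open Sums +-commutativeMonoid public
  open import Algebra.Properties.Monoid.Mult +-monoid using (×-homo-+)
  open import Relation.Binary.Bundles using (Poset)
  open IsTotalOrder isTotalOrder using (isPartialOrder; ≤-respˡ-≈; ≤-respʳ-≈) renaming (trans to ≤-trans; reflexive to ≤-reflexive)

  poset : Poset c ℓ₁ ℓ₂
  poset = record { isPartialOrder = isPartialOrder }

  ·ℕ≡× : ∀ k x → k ·ℕ x ≡ k × x
  ·ℕ≡× zero    x = ≡.refl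
  ·ℕ≡× (suc k) x = ≡.cong (x +_) (·ℕ≡× k x)

  ×-zeroʳ : ∀ k → k × 0# ≈ 0#
  ×-zeroʳ zero    = refl
  ×-zeroʳ (suc k) = trans (+-identityˡ _) (×-zeroʳ k)

  ×-∑ₗ : ∀ {a} {A : Set a} k xs (f : A → Carrier) → k × ∑ₗ xs f ≈ ∑ₗ xs (λ x → k × f x)
  ×-∑ₗ k []       f = ×-zeroʳ k
  ×-∑ₗ k (x ∷ xs) f = trans (×-distrib-+ (f x) _ k) (+-congˡ (×-∑ₗ k xs f))
    where open import Algebra.Properties.CommutativeMonoid.Mult +-commutativeMonoid using (×-distrib-+)

  +-mono-≤ : ∀ {x y u v} → x ≤ y → u ≤ v → (x + u) ≤ (y + v)
  +-mono-≤ {x} {y} {u} {v} x≤y u≤v = ≤-trans (+-monoʳ-≤ x u≤v)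
    (≤-respˡ-≈ (+-comm v x) (≤-respʳ-≈ (+-comm v y) (+-monoʳ-≤ v x≤y)))

  ∑ₗ-mono-≤ : ∀ {a} {A : Set a} xs {f g : A → Carrier} → (∀ x → f x ≤ g x) → ∑ₗ xs f ≤ ∑ₗ xs g
  ∑ₗ-mono-≤ []       f≤g = ≤-reflexive refl
  ∑ₗ-mono-≤ (x ∷ xs) f≤g = +-mono-≤ (f≤g x) (∑ₗ-mono-≤ xs f≤g)

  ×-nonneg : ∀ k {x} → 0# ≤ x → 0# ≤ (k × x)
  ×-nonneg zero    0≤x = ≤-reflexive refl
  ×-nonneg (suc k) 0≤x = ≤-respˡ-≈ (+-identityˡ 0#) (+-mono-≤ 0≤x (×-nonneg k 0≤x))

  ×-monoˡ-≤ : ∀ {a b} → a ℕ.≤ b → ∀ {x} → 0# ≤ x → (a × x) ≤ (b × x)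
  ×-monoˡ-≤ {a} {b} a≤b {x} 0≤x = begin
    a × x                 ≈⟨ +-identityʳ (a × x) ⟨
    a × x + 0#            ≤⟨ +-monoʳ-≤ (a × x) (×-nonneg (b ℕ.∸ a) 0≤x) ⟩
    a × x + (b ℕ.∸ a) × x ≈⟨ ×-homo-+ x a (b ℕ.∸ a) ⟨
    (a ℕ.+ (b ℕ.∸ a)) × x ≡⟨ ≡.cong (_× x) (ℕ.m+[n∸m]≡n a≤b) ⟩
    b × x                 ∎
    where open import Relation.Binary.Reasoning.PartialOrder poset

  norm-as-∑ : ∀ {N : ℕ} (S : Subset N → Bool) (m : Subset N → Carrier) j (ψ : Cochain N) →
    norm F S m j ψ ≈ ∑ₗ (allSubsets N) (λ σ → ⟦ S σ ∧ (∣ σ ∣ ≡ᵇ suc j) ⟧· ⟦ ψ σ ⟧· m σ)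
  norm-as-∑ {N} S m j ψ =
    trans (∑ₗ-filterᵇ ψ (faces S j) m)
          (∑ₗ-filterᵇ (λ σ → S σ ∧ (∣ σ ∣ ≡ᵇ suc j)) (allSubsets N) (λ σ → ⟦ ψ σ ⟧· m σ))

-- The degree k of the theorem is suc j here: k-simplices have 2 + j vertices, (k+1)-simplices 3 + j.
module DoubleCounting {c ℓ₁ ℓ₂} (F : OrderedField c ℓ₁ ℓ₂) {N n : ℕ} (X : Complex N) (W : Weight F X n)
                      (j : ℕ) (2+j≤n : 2 ℕ.+ j ℕ.≤ n) (φ : Cochain N) where
  open OrderedField F hiding (zero; _-_)
  open OrderedFieldSums F
  open Weight W using (m)
  open import Relation.Binary.Reasoning.PartialOrder poset

  S : Subset N → Bool
  S = simplex X

  inXᵏ⁺¹ : Subset N → Bool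
  inXᵏ⁺¹ η = S η ∧ (∣ η ∣ ≡ᵇ 3 ℕ.+ j)

  inXᵏ : Subset N → Bool
  inXᵏ τ = S τ ∧ (∣ τ ∣ ≡ᵇ 2 ℕ.+ j)

  dLocal : Fin N → Cochain N
  dLocal v = d j (localize φ v)

  lhsTerm : Fin N → Subset N → Carrier
  lhsTerm v η = ⟦ v ∈ᵇ η ⟧· ⟦ inXᵏ⁺¹ η ⟧· ⟦ dLocal v (η - v) ⟧· m η

  linkNorm : Fin N → Carrier
  linkNorm v = norm F (link X v) (linkWeight m v) (suc j) (dLocal v)

  linkNorm-as-∑ : ∀ v → linkNorm v ≈ ∑ₗ (allSubsets N) (lhsTerm v)
  linkNorm-as-∑ v = begin-equality
    linkNorm v
      ≈⟨ norm-as-∑ (link X v) (linkWeight m v) (suc j) (dLocal v) ⟩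
    ∑ₗ (allSubsets N) (λ σ → ⟦ link X v σ ∧ (∣ σ ∣ ≡ᵇ 2 ℕ.+ j) ⟧· ⟦ dLocal v σ ⟧· m (σ ∪ ⁅ v ⁆))
      ≈⟨ ∑ₗ-cong (allSubsets N) (λ σ → reflexive (in-link σ)) ⟩
    ∑ₗ (allSubsets N) (λ σ → ⟦ not (v ∈ᵇ σ) ⟧· ⟦ inXᵏ⁺¹ (σ ∪ ⁅ v ⁆) ⟧· ⟦ dLocal v σ ⟧· m (σ ∪ ⁅ v ⁆))
      ≈⟨ ∑ₗ-∪⁅⁆ N v (λ η σ → ⟦ inXᵏ⁺¹ η ⟧· ⟦ dLocal v σ ⟧· m η) ⟩
    ∑ₗ (allSubsets N) (lhsTerm v) ∎
    where
    open SubsetSums +-commutativeMonoid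
    in-link : ∀ σ → ⟦ link X v σ ∧ (∣ σ ∣ ≡ᵇ 2 ℕ.+ j) ⟧· ⟦ dLocal v σ ⟧· m (σ ∪ ⁅ v ⁆) ≡
                    ⟦ not (v ∈ᵇ σ) ⟧· ⟦ inXᵏ⁺¹ (σ ∪ ⁅ v ⁆) ⟧· ⟦ dLocal v σ ⟧· m (σ ∪ ⁅ v ⁆)
    in-link σ with v ∈ᵇ σ in v∈σ
    ... | true  = ≡.refl
    ... | false rewrite x∉ᵇp⇒∣p∪⁅x⁆∣≡1+∣p∣ σ v v∈σ = ≡.refl

  vertex-in-X : ∀ v η → ⟦ S ⁅ v ⁆ ⟧· lhsTerm v η ≡ lhsTerm v η
  vertex-in-X v η with S ⁅ v ⁆ in v∈X | v ∈ᵇ η in v∈η | S η in η∈X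
  ... | true  | _     | _     = ≡.refl
  ... | false | false | _     = ≡.refl
  ... | false | true  | false = ≡.refl
  ... | false | true  | true  = contradiction (≡.subst T v∈X (closed X η ⁅ v ⁆ (≡true⇒T η∈X) ⁅v⁆⊆η (v , x∈⁅x⁆ v))) λ ()
    where
    ⁅v⁆⊆η : ⁅ v ⁆ ⊆ η
    ⁅v⁆⊆η y∈⁅v⁆ = ≡.subst (_∈ η) (≡.sym (x∈⁅y⁆⇒x≡y v y∈⁅v⁆)) (x∈ᵇp⇒x∈p η v v∈η)

  lhs-as-∑ : Σ-list (map linkNorm (vertices X)) ≈ ∑ₗ (allSubsets N) (λ η → ∑[ v < N ] lhsTerm v η)
  lhs-as-∑ = begin-equality
    Σ-list (map linkNorm (vertices X))
      ≈⟨ ∑ₗ-filterᵇ (λ v → S ⁅ v ⁆) (allFin N) linkNorm ⟩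
    ∑ₗ (allFin N) (λ v → ⟦ S ⁅ v ⁆ ⟧· linkNorm v)
      ≡⟨ ∑ₗ-tabulate id (λ v → ⟦ S ⁅ v ⁆ ⟧· linkNorm v) ⟩
    ∑[ v < N ] ⟦ S ⁅ v ⁆ ⟧· linkNorm v
      ≈⟨ sum-cong-≋ (λ v → ⟦⟧-congʳ (S ⁅ v ⁆) (linkNorm-as-∑ v)) ⟩
    ∑[ v < N ] ⟦ S ⁅ v ⁆ ⟧· ∑ₗ (allSubsets N) (lhsTerm v)
      ≈⟨ sum-cong-≋ (λ v → trans (sym (∑ₗ-⟦⟧ (allSubsets N) (S ⁅ v ⁆) (lhsTerm v)))
                                  (∑ₗ-cong (allSubsets N) (λ η → reflexive (vertex-in-X v η)))) ⟩
    ∑[ v < N ] ∑ₗ (allSubsets N) (lhsTerm v)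
      ≈⟨ ∑-∑ₗ-comm (allSubsets N) lhsTerm ⟩
    ∑ₗ (allSubsets N) (λ η → ∑[ v < N ] lhsTerm v η) ∎

  rhsTerm : Subset N → Carrier
  rhsTerm η = suc j × ⟦ inXᵏ⁺¹ η ⟧· ⟦ d (suc j) φ η ⟧· m η
               + ∑ₗ (allSubsets N) (λ τ → ⟦ inXᵏ⁺¹ η ∧ τ ⊆ᵇ η ⟧· ⟦ inXᵏ τ ∧ φ τ ⟧· m η)

  balance-∑ : ∀ τ → inXᵏ τ ≡ true → m τ ≈ ∑ₗ (allSubsets N) (λ η → ⟦ inXᵏ⁺¹ η ∧ τ ⊆ᵇ η ⟧· m η)
  balance-∑ τ τ∈Xᵏ with Equivalence.to T-∧ (≡true⇒T τ∈Xᵏ)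
  ... | τ∈X , ∣τ∣≡2+j = begin-equality
    m τ
      ≈⟨ Weight.balance W (suc j) τ 2+j≤n τ∈X (ℕ.≡ᵇ⇒≡ ∣ τ ∣ (2 ℕ.+ j) ∣τ∣≡2+j) ⟩
    ∑ₗ (filterᵇ (τ ⊆ᵇ_) (faces S (2 ℕ.+ j))) m
      ≈⟨ ∑ₗ-filterᵇ (τ ⊆ᵇ_) (faces S (2 ℕ.+ j)) m ⟩
    ∑ₗ (faces S (2 ℕ.+ j)) (λ η → ⟦ τ ⊆ᵇ η ⟧· m η)
      ≈⟨ ∑ₗ-filterᵇ inXᵏ⁺¹ (allSubsets N) _ ⟩
    ∑ₗ (allSubsets N) (λ η → ⟦ inXᵏ⁺¹ η ⟧· ⟦ τ ⊆ᵇ η ⟧· m η)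
      ≈⟨ ∑ₗ-cong (allSubsets N) (λ η → reflexive (⟦⟧-∧ (inXᵏ⁺¹ η) (τ ⊆ᵇ η) (m η))) ⟨
    ∑ₗ (allSubsets N) (λ η → ⟦ inXᵏ⁺¹ η ∧ τ ⊆ᵇ η ⟧· m η) ∎

  spread-over-cofaces : ∀ τ → ⟦ inXᵏ τ ∧ φ τ ⟧· m τ ≈
                        ∑ₗ (allSubsets N) (λ η → ⟦ inXᵏ⁺¹ η ∧ τ ⊆ᵇ η ⟧· ⟦ inXᵏ τ ∧ φ τ ⟧· m η)
  spread-over-cofaces τ with inXᵏ τ in τ∈Xᵏ
  ... | false = sym (∑ₗ-zero (allSubsets N) (λ η → reflexive (⟦⟧-ε (inXᵏ⁺¹ η ∧ τ ⊆ᵇ η))))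
  ... | true  = begin-equality
    ⟦ φ τ ⟧· m τ
      ≈⟨ ⟦⟧-congʳ (φ τ) (balance-∑ τ τ∈Xᵏ) ⟩
    ⟦ φ τ ⟧· ∑ₗ (allSubsets N) (λ η → ⟦ inXᵏ⁺¹ η ∧ τ ⊆ᵇ η ⟧· m η)
      ≈⟨ ∑ₗ-⟦⟧ (allSubsets N) (φ τ) _ ⟨
    ∑ₗ (allSubsets N) (λ η → ⟦ φ τ ⟧· ⟦ inXᵏ⁺¹ η ∧ τ ⊆ᵇ η ⟧· m η)
      ≈⟨ ∑ₗ-cong (allSubsets N) (λ η → reflexive (⟦⟧-comm (φ τ) (inXᵏ⁺¹ η ∧ τ ⊆ᵇ η) (m η))) ⟩
    ∑ₗ (allSubsets N) (λ η → ⟦ inXᵏ⁺¹ η ∧ τ ⊆ᵇ η ⟧· ⟦ φ τ ⟧· m η) ∎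

  normφ-as-∑ : norm F S m (suc j) φ ≈
               ∑ₗ (allSubsets N) (λ η → ∑ₗ (allSubsets N) (λ τ → ⟦ inXᵏ⁺¹ η ∧ τ ⊆ᵇ η ⟧· ⟦ inXᵏ τ ∧ φ τ ⟧· m η))
  normφ-as-∑ = begin-equality
    norm F S m (suc j) φ
      ≈⟨ norm-as-∑ S m (suc j) φ ⟩
    ∑ₗ (allSubsets N) (λ τ → ⟦ inXᵏ τ ⟧· ⟦ φ τ ⟧· m τ)
      ≈⟨ ∑ₗ-cong (allSubsets N) (λ τ → trans (reflexive (≡.sym (⟦⟧-∧ (inXᵏ τ) (φ τ) (m τ)))) (spread-over-cofaces τ)) ⟩
    ∑ₗ (allSubsets N) (λ τ → ∑ₗ (allSubsets N) (λ η → ⟦ inXᵏ⁺¹ η ∧ τ ⊆ᵇ η ⟧· ⟦ inXᵏ τ ∧ φ τ ⟧· m η))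
      ≈⟨ ∑ₗ-comm (allSubsets N) (allSubsets N) _ ⟩
    ∑ₗ (allSubsets N) (λ η → ∑ₗ (allSubsets N) (λ τ → ⟦ inXᵏ⁺¹ η ∧ τ ⊆ᵇ η ⟧· ⟦ inXᵏ τ ∧ φ τ ⟧· m η)) ∎

  rhs-as-∑ : (suc j ·ℕ norm F S m (2 ℕ.+ j) (d (suc j) φ)) + norm F S m (suc j) φ ≈ ∑ₗ (allSubsets N) rhsTerm
  rhs-as-∑ = begin-equality
    (suc j ·ℕ norm F S m (2 ℕ.+ j) (d (suc j) φ)) + norm F S m (suc j) φ
      ≡⟨ ≡.cong (_+ norm F S m (suc j) φ) (·ℕ≡× (suc j) _) ⟩
    suc j × norm F S m (2 ℕ.+ j) (d (suc j) φ) + norm F S m (suc j) φ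
      ≈⟨ +-cong (×-congʳ (suc j) (norm-as-∑ S m (2 ℕ.+ j) (d (suc j) φ))) normφ-as-∑ ⟩
    suc j × ∑ₗ (allSubsets N) (λ η → ⟦ inXᵏ⁺¹ η ⟧· ⟦ d (suc j) φ η ⟧· m η) +
    ∑ₗ (allSubsets N) (λ η → ∑ₗ (allSubsets N) (λ τ → ⟦ inXᵏ⁺¹ η ∧ τ ⊆ᵇ η ⟧· ⟦ inXᵏ τ ∧ φ τ ⟧· m η))
      ≈⟨ +-congʳ (×-∑ₗ (suc j) (allSubsets N) _) ⟩
    ∑ₗ (allSubsets N) (λ η → suc j × ⟦ inXᵏ⁺¹ η ⟧· ⟦ d (suc j) φ η ⟧· m η) +
    ∑ₗ (allSubsets N) (λ η → ∑ₗ (allSubsets N) (λ τ → ⟦ inXᵏ⁺¹ η ∧ τ ⊆ᵇ η ⟧· ⟦ inXᵏ τ ∧ φ τ ⟧· m η))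
      ≈⟨ ∑ₗ-distrib (allSubsets N) _ _ ⟨
    ∑ₗ (allSubsets N) rhsTerm ∎
    where open import Algebra.Properties.Monoid.Mult +-monoid using (×-congʳ)

  face-closure : ∀ η → T (S η) → ∀ τ x →
    ⟦ τ ⊆ᵇ η ⟧· ⟦ inXᵏ τ ∧ φ τ ⟧· x ≡ ⟦ τ ⊆ᵇ η ∧ (∣ τ ∣ ≡ᵇ 2 ℕ.+ j) ⟧· ⟦ φ τ ⟧· x
  face-closure η η∈X τ x with τ ⊆? η
  ... | no _ = ≡.refl
  ... | yes τ⊆η with S τ in τ∈X
  ...   | true  = ⟦⟧-∧ (∣ τ ∣ ≡ᵇ 2 ℕ.+ j) (φ τ) x
  ...   | false with ∣ τ ∣ ≡ᵇ 2 ℕ.+ j in ∣τ∣≡2+j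
  ...     | false = ≡.refl
  ...     | true  = contradiction (≡.subst T τ∈X (closed X η τ η∈X τ⊆η τ≢∅)) λ ()
    where
    τ≢∅ : Nonempty τ
    τ≢∅ = ∣p∣≡1+m⇒Nonempty τ (ℕ.≡ᵇ⇒≡ ∣ τ ∣ (2 ℕ.+ j) (≡true⇒T ∣τ∣≡2+j))

  module _ (η : Subset N) (η∉Xᵏ⁺¹ : inXᵏ⁺¹ η ≡ false) where

    lhsTerms-outside : ∑[ v < N ] lhsTerm v η ≈ 0#
    lhsTerms-outside = ∑-zero vanishes
      where
      vanishes : ∀ v → lhsTerm v η ≈ 0#
      vanishes v rewrite η∉Xᵏ⁺¹ = reflexive (⟦⟧-ε (v ∈ᵇ η))

    rhsTerm-outside : rhsTerm η ≈ 0#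
    rhsTerm-outside rewrite η∉Xᵏ⁺¹ =
      trans (+-cong (×-zeroʳ (suc j)) (∑ₗ-zero (allSubsets N) (λ _ → refl))) (+-identityˡ 0#)

  module _ (η : Subset N) (η∈Xᵏ⁺¹ : inXᵏ⁺¹ η ≡ true) where
    open SubsetSums +-commutativeMonoid
    open import Algebra.Properties.Monoid.Mult +-monoid using (×-homo-+)

    private
      η∈X : T (S η)
      η∈X = proj₁ (Equivalence.to T-∧ (≡true⇒T η∈Xᵏ⁺¹))

      ∣η∣≡3+j : ∣ η ∣ ≡ 3 ℕ.+ j
      ∣η∣≡3+j = ℕ.≡ᵇ⇒≡ ∣ η ∣ (3 ℕ.+ j) (proj₂ (Equivalence.to T-∧ (≡true⇒T η∈Xᵏ⁺¹)))

      inη : Fin N → Bool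
      inη u = u ∈ᵇ η

      φ-facet : Fin N → Bool
      φ-facet u = φ (η - u)

    lhsTerms-inside : ∑[ v < N ] lhsTerm v η ≈ count (λ v → inη v ∧ (d (suc j) φ η xor φ-facet v)) × m η
    lhsTerms-inside = begin-equality
      ∑[ v < N ] lhsTerm v η
        ≈⟨ sum-cong-≋ (λ v → reflexive (localized v)) ⟩
      ∑[ v < N ] ⟦ inη v ∧ (d (suc j) φ η xor φ-facet v) ⟧· m η
        ≈⟨ ∑-⟦⟧-const (λ v → inη v ∧ (d (suc j) φ η xor φ-facet v)) (m η) ⟩
      count (λ v → inη v ∧ (d (suc j) φ η xor φ-facet v)) × m η ∎
      where
      localized : ∀ v → lhsTerm v η ≡ ⟦ inη v ∧ (d (suc j) φ η xor φ-facet v) ⟧· m η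
      localized v rewrite η∈Xᵏ⁺¹ with v ∈ᵇ η in v∈η
      ... | false = ≡.refl
      ... | true  = ≡.cong (⟦_⟧· m η) (Coboundary.d-localize j φ η v v∈η ∣η∣≡3+j)

    rhsTerm-inside : rhsTerm η ≈ suc j × ⟦ d (suc j) φ η ⟧· m η + count (λ u → inη u ∧ φ-facet u) × m η
    rhsTerm-inside = begin-equality
      rhsTerm η
        ≡⟨ ≡.cong (λ b → suc j × ⟦ b ⟧· ⟦ d (suc j) φ η ⟧· m η
                         + ∑ₗ (allSubsets N) (λ τ → ⟦ b ∧ τ ⊆ᵇ η ⟧· ⟦ inXᵏ τ ∧ φ τ ⟧· m η)) η∈Xᵏ⁺¹ ⟩
      suc j × ⟦ d (suc j) φ η ⟧· m η + ∑ₗ (allSubsets N) (λ τ → ⟦ τ ⊆ᵇ η ⟧· ⟦ inXᵏ τ ∧ φ τ ⟧· m η)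
        ≈⟨ +-congˡ (∑ₗ-cong (allSubsets N) (λ τ → reflexive (face-closure η η∈X τ (m η)))) ⟩
      suc j × ⟦ d (suc j) φ η ⟧· m η + ∑ₗ (allSubsets N) (λ τ → ⟦ τ ⊆ᵇ η ∧ (∣ τ ∣ ≡ᵇ 2 ℕ.+ j) ⟧· ⟦ φ τ ⟧· m η)
        ≈⟨ +-congˡ (∑ₗ-⊆-facets N η (2 ℕ.+ j) ∣η∣≡3+j _) ⟩
      suc j × ⟦ d (suc j) φ η ⟧· m η + ∑[ u < N ] ⟦ inη u ⟧· ⟦ φ-facet u ⟧· m η
        ≈⟨ +-congˡ (sum-cong-≋ (λ u → reflexive (⟦⟧-∧ (inη u) (φ-facet u) (m η)))) ⟨
      suc j × ⟦ d (suc j) φ η ⟧· m η + ∑[ u < N ] ⟦ inη u ∧ φ-facet u ⟧· m η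
        ≈⟨ +-congˡ (∑-⟦⟧-const (λ u → inη u ∧ φ-facet u) (m η)) ⟩
      suc j × ⟦ d (suc j) φ η ⟧· m η + count (λ u → inη u ∧ φ-facet u) × m η ∎

    parity-bound : ∀ s → d (suc j) φ η ≡ s →
      (count (λ v → inη v ∧ (s xor φ-facet v)) × m η) ≤ (suc j × ⟦ s ⟧· m η + count (λ u → inη u ∧ φ-facet u) × m η)
    parity-bound false _ = begin
      count (λ u → inη u ∧ φ-facet u) × m η              ≈⟨ +-identityˡ _ ⟨
      0# + count (λ u → inη u ∧ φ-facet u) × m η         ≈⟨ +-congʳ (×-zeroʳ (suc j)) ⟨
      suc j × 0# + count (λ u → inη u ∧ φ-facet u) × m η ∎
    parity-bound true odd = begin
      count (λ u → inη u ∧ not (φ-facet u)) × m η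
        ≤⟨ ×-monoˡ-≤ (ParitySums.∑≡true⇒count-∧-not≤ (suc j) inη φ-facet ∣η∣≤3+j
                        (≡.trans (≡.sym (Coboundary.d-facets (suc j) φ η ∣η∣≡3+j)) odd))
                     (proj₁ (Weight.pos W η η∈X)) ⟩
      (suc j ℕ.+ count (λ u → inη u ∧ φ-facet u)) × m η
        ≈⟨ ×-homo-+ (m η) (suc j) _ ⟩
      suc j × m η + count (λ u → inη u ∧ φ-facet u) × m η ∎
      where
      ∣η∣≤3+j : count inη ℕ.≤ 2 ℕ.+ suc j
      ∣η∣≤3+j = ℕ.≤-reflexive (≡.trans (count-∈ᵇ η) ∣η∣≡3+j)

    lhsTerms≤rhsTerm-inside : (∑[ v < N ] lhsTerm v η) ≤ rhsTerm η
    lhsTerms≤rhsTerm-inside = begin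
      ∑[ v < N ] lhsTerm v η
        ≈⟨ lhsTerms-inside ⟩
      count (λ v → inη v ∧ (d (suc j) φ η xor φ-facet v)) × m η
        ≤⟨ parity-bound (d (suc j) φ η) ≡.refl ⟩
      suc j × ⟦ d (suc j) φ η ⟧· m η + count (λ u → inη u ∧ φ-facet u) × m η
        ≈⟨ rhsTerm-inside ⟨
      rhsTerm η ∎

  lhsTerms≤rhsTerm : ∀ η → (∑[ v < N ] lhsTerm v η) ≤ rhsTerm η
  lhsTerms≤rhsTerm η = by-cases (inXᵏ⁺¹ η) ≡.refl
    where
    by-cases : ∀ b → inXᵏ⁺¹ η ≡ b → (∑[ v < N ] lhsTerm v η) ≤ rhsTerm η
    by-cases true  η∈Xᵏ⁺¹ = lhsTerms≤rhsTerm-inside η η∈Xᵏ⁺¹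
    by-cases false η∉Xᵏ⁺¹ = begin
      ∑[ v < N ] lhsTerm v η  ≈⟨ lhsTerms-outside η η∉Xᵏ⁺¹ ⟩
      0#                      ≈⟨ rhsTerm-outside η η∉Xᵏ⁺¹ ⟨
      rhsTerm η               ∎

  ∑-linkNorm≤ : Σ-list (map linkNorm (vertices X)) ≤
                ((suc j ·ℕ norm F S m (2 ℕ.+ j) (d (suc j) φ)) + norm F S m (suc j) φ)
  ∑-linkNorm≤ = begin
    Σ-list (map linkNorm (vertices X))                ≈⟨ lhs-as-∑ ⟩
    ∑ₗ (allSubsets N) (λ η → ∑[ v < N ] lhsTerm v η)  ≤⟨ ∑ₗ-mono-≤ (allSubsets N) lhsTerms≤rhsTerm ⟩
    ∑ₗ (allSubsets N) rhsTerm                         ≈⟨ rhs-as-∑ ⟨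
    (suc j ·ℕ norm F S m (2 ℕ.+ j) (d (suc j) φ)) + norm F S m (suc j) φ ∎

open import Data.Nat using (ℕ; suc; _≤_; _+_; _∸_)
open import Data.List using (map)

proposition4p4 : ∀ {c ℓ₁ ℓ₂} (F : OrderedField c ℓ₁ ℓ₂) {N : ℕ} (X : Complex N) (n : ℕ)
    → Pure X n → (W : Weight F X n) → (k : ℕ) → 1 ≤ k → k + 1 ≤ n → (φ : Cochain N)
    → OrderedField._≤_ F
        (OrderedField.Σ-list F (map (λ v → norm F (link X v) (linkWeight (Weight.m W) v) k (d (k ∸ 1) (localize φ v))) (vertices X)))
        (OrderedField._+_ F (OrderedField._·ℕ_ F k (norm F (simplex X) (Weight.m W) (suc k) (d k φ))) (norm F (simplex X) (Weight.m W) k φ))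
proposition4p4 F X n _ W (suc j) (s≤s z≤n) k+1≤n φ =
  DoubleCounting.∑-linkNorm≤ F X W j (≡.subst (_≤ n) (ℕ.+-comm (suc j) 1) k+1≤n) φ
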